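{- The optimal value of the linear program $\max\sum_{f\in\mathcal{F}}w_f z_f$ subject to $z_f\le\min(1,\sum_{e\in E_f}x_e)$ for all $f\in\mathcal{F}$; $\sum_{e\in E_i}x_e\le b_i$ for all $i\in I$; $x_e\le r_j$ for all $j\in J$, $e\in E_j$; $\sum_{e\in E_j}x_e\le b_j r_j$ for all $j\in J$; $0\le x_e,z_f\le1$ for all $e\in E,f\in\mathcal{F}$, is an upper bound on the expected objective value of a clairvoyant optimum for ONline Capacitated Coverage Maximization.
   Context: ONline Capacitated Coverage Maximization: given in advance a bipartite graph $G=(I,J,E)$ (offline task types $I$, online worker types $J$), feature set $\mathcal{K}$, vectors $\chi_j\in\{0,1\}^{\mathcal{K}}$, weights $w_{ik}\in[0,1]$, positive integer capacities $b_i,b_j$, horizon $T$, arrival rates $r_j>0$ with $\sum_j r_j=T$. In each of $T$ rounds one worker arrives, independently, of type $j$ with probability $r_j/T$. Each arriving worker of type $j$ may be assigned to at most $b_j$ tasks in its neighbourhood, each task $i$ receives at most $b_i$ assignments in total; task $i$'s utility is $\sum_k w_{ik}\min(1,n_{ik})$ with $n_{ik}$ the number of workers covering $k$ assigned to $i$; the objective is the sum over tasks. A clairvoyant optimum sees the full arrival sequence and then picks a best feasible assignment. Notation: $E_\ell$ = edges incident to node $\ell$; $\mathcal{F}=I\times\mathcal{K}$; for $f=(i,k)$, $w_f=w_{ik}$, $E_f=\{(i,j)\in E_i:\chi_{jk}=1\}$.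
   Formalization: The weights $w_{ik}$ and the arrival rates $r_j$ take rational values. -}

module Defs where

open import Data.Nat as ℕ using (ℕ; zero; suc; _≤ᵇ_)
open import Data.Integer using (+_)
open import Data.Rational using (ℚ; 0ℚ; 1ℚ; _+_; _*_; _⊔_; _/_; _≤_; _<_)
open import Data.Bool using (Bool; true; false; _∧_; _∨_; if_then_else_)
open import Data.Fin using (Fin; zero; suc)
open import Data.List using (List; []; _∷_; map; concatMap; foldr; allFin)
open import Data.Vec using (Vec; []; _∷_; lookup)
open import Data.Product using (_×_; Σ)
open import Relation.Binary.PropositionalEquality using (_≡_)

sumℚ : (n : ℕ) → (Fin n → ℚ) → ℚ
sumℚ zero    f = 0ℚ
sumℚ (suc n) f = f zero + sumℚ n (λ i → f (suc i))

prodℚ : (n : ℕ) → (Fin n → ℚ) → ℚ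
prodℚ zero    f = 1ℚ
prodℚ (suc n) f = f zero * prodℚ n (λ i → f (suc i))

count : (n : ℕ) → (Fin n → Bool) → ℕ
count zero    f = 0
count (suc n) f = (if f zero then 1 else 0) ℕ.+ count n (λ i → f (suc i))

anyFin : (n : ℕ) → (Fin n → Bool) → Bool
anyFin zero    f = false
anyFin (suc n) f = f zero ∨ anyFin n (λ i → f (suc i))

allFinB : (n : ℕ) → (Fin n → Bool) → Bool
allFinB zero    f = true
allFinB (suc n) f = f zero ∧ allFinB n (λ i → f (suc i))

[_]·_ : Bool → ℚ → ℚ
[ b ]· q = if b then q else 0ℚ

-- ℕ ↦ ℚ and 1/T (with the harmless convention 1/0 = 0)
ℕtoℚ : ℕ → ℚ
ℕtoℚ n = + n / 1

inv : ℕ → ℚ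
inv zero    = 0ℚ
inv (suc n) = + 1 / suc n

allVecs : {A : Set} → List A → (n : ℕ) → List (Vec A n)
allVecs xs zero    = [] ∷ []
allVecs xs (suc n) = concatMap (λ x → map (x ∷_) (allVecs xs n)) xs

maxList : List ℚ → ℚ
maxList = foldr _⊔_ 0ℚ

-- Problem instance (types I = Fin nI, J = Fin nJ, features K = Fin nK)

record Instance : Set where
  field
    nI nJ nK : ℕ
    E   : Fin nI → Fin nJ → Bool
    χ   : Fin nJ → Fin nK → Bool
    w   : Fin nI → Fin nK → ℚ
    bI  : Fin nI → ℕ
    bJ  : Fin nJ → ℕ
    T   : ℕ
    r   : Fin nJ → ℚ

module _ (P : Instance) where
  open Instance P

  WellFormed : Set
  WellFormed =
      ((i : Fin nI) (k : Fin nK) → (0ℚ ≤ w i k) × (w i k ≤ 1ℚ))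
    × ((i : Fin nI) → 1 ℕ.≤ bI i)
    × ((j : Fin nJ) → 1 ℕ.≤ bJ j)
    × ((j : Fin nJ) → 0ℚ < r j)
    × (sumℚ nJ r ≡ ℕtoℚ T)

  -- an arrival sequence: the type of the worker arriving in each round
  Seq : Set
  Seq = Vec (Fin nJ) T

  prob : Seq → ℚ
  prob s = prodℚ T (λ t → r (lookup s t) * inv T)

  -- an assignment: a t i = true iff the worker of round t is assigned to task i
  Assignment : Set
  Assignment = Vec (Vec Bool nI) T

  assigned : Assignment → Fin T → Fin nI → Bool
  assigned a t i = lookup (lookup a t) i

  feasible : Seq → Assignment → Bool
  feasible s a =
       allFinB T (λ t → allFinB nI (λ i →
            if assigned a t i then E i (lookup s t) else true))
    ∧ allFinB T (λ t → count nI (λ i → assigned a t i) ≤ᵇ bJ (lookup s t))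
    ∧ allFinB nI (λ i → count T (λ t → assigned a t i) ≤ᵇ bI i)

  -- objective: Σ_i Σ_k w_ik min(1, n_ik)
  value : Seq → Assignment → ℚ
  value s a = sumℚ nI (λ i → sumℚ nK (λ k →
      [ anyFin T (λ t → assigned a t i ∧ χ (lookup s t) k) ]· w i k))

  allAssignments : List Assignment
  allAssignments = allVecs (allVecs (true ∷ false ∷ []) nI) T

  -- clairvoyant optimum for a given arrival sequence
  -- (the empty assignment is always feasible and all values are ≥ 0,
  --  so the default 0 of maxList is harmless)
  clairvoyantOPT : Seq → ℚ
  clairvoyantOPT s =
    maxList (map (λ a → [ feasible s a ]· value s a) allAssignments)

  expectedOPT : ℚ
  expectedOPT = foldr _+_ 0ℚ
    (map (λ s → prob s * clairvoyantOPT s) (allVecs (allFin nJ) T))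

  -- the LP. Variables x_e for e = (i,j) ∈ E (values at non-edges are
  -- never used), z_f for f = (i,k) ∈ F = I × K.
  -- Σ_{e ∈ E_f} x_e
  coverSum : (Fin nI → Fin nJ → ℚ) → Fin nI → Fin nK → ℚ
  coverSum x i k = sumℚ nJ (λ j → [ E i j ∧ χ j k ]· x i j)

  LPFeasible : (Fin nI → Fin nJ → ℚ) → (Fin nI → Fin nK → ℚ) → Set
  LPFeasible x z =
      ((i : Fin nI) (k : Fin nK) → (z i k ≤ 1ℚ) × (z i k ≤ coverSum x i k))
    × ((i : Fin nI) → sumℚ nJ (λ j → [ E i j ]· x i j) ≤ ℕtoℚ (bI i))
    × ((i : Fin nI) (j : Fin nJ) → E i j ≡ true → x i j ≤ r j)
    × ((j : Fin nJ) → sumℚ nI (λ i → [ E i j ]· x i j) ≤ ℕtoℚ (bJ j) * r j)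
    × ((i : Fin nI) (j : Fin nJ) → E i j ≡ true → (0ℚ ≤ x i j) × (x i j ≤ 1ℚ))
    × ((i : Fin nI) (k : Fin nK) → (0ℚ ≤ z i k) × (z i k ≤ 1ℚ))

  LPObjective : (Fin nI → Fin nK → ℚ) → ℚ
  LPObjective z = sumℚ nI (λ i → sumℚ nK (λ k → w i k * z i k))

  -- "v is an upper bound on the optimal value of the LP's max"
  -- is witnessed by the LP optimum being ≥ v: since the LP is a bounded
  -- feasible LP with rational data, its optimum is attained, so
  -- "LP-OPT ≥ v" ⇔ ∃ feasible (x,z) with objective ≥ v.
  LPValueAtLeast : ℚ → Set
  LPValueAtLeast v = Σ (Fin nI → Fin nJ → ℚ) λ x → Σ (Fin nI → Fin nK → ℚ) λ z →
    LPFeasible x z × (v ≤ LPObjective z)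

{-# OPTIONS --safe #-}
-- For each arrival sequence s fix an optimal feasible assignment, and let
-- x i j (s) indicate that some worker of type j is assigned to task i and
-- z i k (s) that feature k is covered at task i.  Pointwise in s these
-- indicators satisfy every LP constraint, except that the rate r j is
-- replaced by the number of type-j arrivals in s, and their objective is the
-- clairvoyant value of s.  All constraints are linear, so taking expectations
-- gives an LP-feasible point with objective at least E[OPT], the arrival counts
-- averaging to T · (r j / T) = r j.
module Submission where

open import Defs
open import Algebra.Bundles using (CommutativeMonoid)
open import Data.Bool using (Bool; true; false; _∧_; _∨_; if_then_else_)
open import Data.Bool.Properties using (T-≡; ∧-identityʳ; ∧-zeroʳ; ∨-zeroʳ)
open import Data.Fin using (Fin; zero; suc)
open import Data.Fin.Properties using (_≟_)
import Data.Integer as ℤ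
import Data.Integer.Properties as ℤ
open import Data.List using (List; []; _∷_; _++_; map; concatMap; foldr; allFin; tabulate)
import Data.List.Properties as List
open import Data.Nat as ℕ using (ℕ; zero; suc; z≤n; s≤s; _≤ᵇ_)
open import Data.Nat.Properties using (≤ᵇ⇒≤)
open import Data.Product using (Σ-syntax; _×_; _,_; proj₁; proj₂)
open import Data.Rational using (ℚ; 0ℚ; 1ℚ; _+_; _*_; _≤_; toℚᵘ; nonNegative)
open import Data.Rational.Properties hiding (_≟_; ≤ᵇ⇒≤)
import Data.Rational.Unnormalised as ℚᵘ
import Data.Rational.Unnormalised.Properties as ℚᵘ
open import Data.Sum using (inj₁; inj₂)
open import Data.Vec using (Vec; []; _∷_; lookup; replicate)
open import Data.Vec.Properties using (lookup-replicate)
open import Function using (_∘_)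
open import Function.Bundles using (Equivalence)
open import Relation.Nullary using (does; yes; no)
open import Relation.Nullary.Decidable using (dec-true)
open import Relation.Binary.PropositionalEquality

open import Algebra.Properties.CommutativeSemigroup
  (CommutativeMonoid.commutativeSemigroup +-0-commutativeMonoid) using (interchange)
open import Algebra.Properties.CommutativeSemigroup
  (CommutativeMonoid.commutativeSemigroup *-1-commutativeMonoid) using (x∙yz≈y∙xz)

private variable
  A B : Set

0≤1 : 0ℚ ≤ 1ℚ
0≤1 = nonNegative⁻¹ 1ℚ

*-nonNeg : ∀ {p q} → 0ℚ ≤ p → 0ℚ ≤ q → 0ℚ ≤ p * q
*-nonNeg {p} {q} 0≤p 0≤q =
  nonNegative⁻¹ (p * q) {{nonNeg*nonNeg⇒nonNeg p {{nonNegative 0≤p}} q {{nonNegative 0≤q}}}}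

*-monoˡ-≤-nonNeg′ : ∀ {r p q} → 0ℚ ≤ r → p ≤ q → r * p ≤ r * q
*-monoˡ-≤-nonNeg′ {r} 0≤r = *-monoˡ-≤-nonNeg r {{nonNegative 0≤r}}

p≤p+q : ∀ {p q} → 0ℚ ≤ q → p ≤ p + q
p≤p+q {p} {q} 0≤q = subst (_≤ p + q) (+-identityʳ p) (+-monoʳ-≤ p 0≤q)

ℕtoℚ-suc : ∀ n → ℕtoℚ (suc n) ≡ 1ℚ + ℕtoℚ n
ℕtoℚ-suc n = toℚᵘ-injective (begin
  toℚᵘ (ℕtoℚ (suc n))
    ≈⟨ toℚᵘ-fromℚᵘ (ℚᵘ.mkℚᵘ (ℤ.+ suc n) 0) ⟩
  ℚᵘ.mkℚᵘ (ℤ.+ suc n) 0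
    ≈⟨ ℚᵘ.*≡* (cong (λ m → (ℤ.+ 1 ℤ.+ m) ℤ.* ℤ.+ 1) (sym (ℤ.*-identityʳ (ℤ.+ n)))) ⟩
  ℚᵘ.1ℚᵘ ℚᵘ.+ ℚᵘ.mkℚᵘ (ℤ.+ n) 0
    ≈⟨ ℚᵘ.+-congʳ ℚᵘ.1ℚᵘ (toℚᵘ-fromℚᵘ (ℚᵘ.mkℚᵘ (ℤ.+ n) 0)) ⟨
  toℚᵘ 1ℚ ℚᵘ.+ toℚᵘ (ℕtoℚ n)
    ≈⟨ toℚᵘ-homo-+ 1ℚ (ℕtoℚ n) ⟨
  toℚᵘ (1ℚ + ℕtoℚ n) ∎)
  where open ℚᵘ.≃-Reasoning

ℕtoℚ*inv≡1 : ∀ n → ℕtoℚ (suc n) * inv (suc n) ≡ 1ℚ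
ℕtoℚ*inv≡1 n = toℚᵘ-injective (begin
  toℚᵘ (ℕtoℚ (suc n) * inv (suc n))
    ≈⟨ toℚᵘ-homo-* (ℕtoℚ (suc n)) (inv (suc n)) ⟩
  toℚᵘ (ℕtoℚ (suc n)) ℚᵘ.* toℚᵘ (inv (suc n))
    ≈⟨ ℚᵘ.*-cong (toℚᵘ-fromℚᵘ (ℚᵘ.mkℚᵘ (ℤ.+ suc n) 0)) (toℚᵘ-fromℚᵘ (ℚᵘ.mkℚᵘ (ℤ.+ 1) n)) ⟩
  ℚᵘ.mkℚᵘ (ℤ.+ suc n) 0 ℚᵘ.* ℚᵘ.mkℚᵘ (ℤ.+ 1) n
    ≈⟨ ℚᵘ.*-inverseʳ (ℚᵘ.mkℚᵘ (ℤ.+ suc n) 0) ⟩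
  ℚᵘ.1ℚᵘ ∎)
  where open ℚᵘ.≃-Reasoning

inv-nonNeg : ∀ n → 0ℚ ≤ inv n
inv-nonNeg zero    = ≤-refl
inv-nonNeg (suc n) = nonNegative⁻¹ (inv (suc n)) {{normalize-nonNeg 1 (suc n)}}

ℕtoℚ-nonNeg : ∀ n → 0ℚ ≤ ℕtoℚ n
ℕtoℚ-nonNeg zero    = ≤-refl
ℕtoℚ-nonNeg (suc n) = subst (0ℚ ≤_) (sym (ℕtoℚ-suc n)) (≤-trans 0≤1 (p≤p+q (ℕtoℚ-nonNeg n)))

ℕtoℚ-mono-≤ : ∀ {m n} → m ℕ.≤ n → ℕtoℚ m ≤ ℕtoℚ n
ℕtoℚ-mono-≤ {n = n} z≤n = ℕtoℚ-nonNeg n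
ℕtoℚ-mono-≤ (s≤s {m} {n} m≤n) =
  subst₂ _≤_ (sym (ℕtoℚ-suc m)) (sym (ℕtoℚ-suc n)) (+-monoʳ-≤ 1ℚ (ℕtoℚ-mono-≤ m≤n))

𝟙 : Bool → ℚ
𝟙 b = [ b ]· 1ℚ

𝟙-nonNeg : ∀ b → 0ℚ ≤ 𝟙 b
𝟙-nonNeg true  = 0≤1
𝟙-nonNeg false = ≤-refl

𝟙-≤1 : ∀ b → 𝟙 b ≤ 1ℚ
𝟙-≤1 true  = ≤-refl
𝟙-≤1 false = 0≤1

𝟙-∧-≤ʳ : ∀ b c → 𝟙 (b ∧ c) ≤ 𝟙 c
𝟙-∧-≤ʳ true  c = ≤-refl
𝟙-∧-≤ʳ false c = 𝟙-nonNeg c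

[]·-≤ : ∀ b {p} → 0ℚ ≤ p → [ b ]· p ≤ p
[]·-≤ true  0≤p = ≤-refl
[]·-≤ false 0≤p = 0≤p

[]·-nonNeg : ∀ b {p} → 0ℚ ≤ p → 0ℚ ≤ [ b ]· p
[]·-nonNeg true  0≤p = 0≤p
[]·-nonNeg false 0≤p = ≤-refl

[]·≡*𝟙 : ∀ b p → [ b ]· p ≡ p * 𝟙 b
[]·≡*𝟙 true  p = sym (*-identityʳ p)
[]·≡*𝟙 false p = sym (*-zeroʳ p)

[]·𝟙-true : ∀ {b c} → b ≡ true → c ≡ true → [ b ]· 𝟙 c ≡ 1ℚ
[]·𝟙-true refl refl = refl

sumℚ-cong : ∀ {n} {f g : Fin n → ℚ} → (∀ i → f i ≡ g i) → sumℚ n f ≡ sumℚ n g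
sumℚ-cong {zero}  f≗g = refl
sumℚ-cong {suc n} f≗g = cong₂ _+_ (f≗g zero) (sumℚ-cong (f≗g ∘ suc))

sumℚ-zero : ∀ n → sumℚ n (λ _ → 0ℚ) ≡ 0ℚ
sumℚ-zero zero    = refl
sumℚ-zero (suc n) = trans (+-identityˡ _) (sumℚ-zero n)

sumℚ-+ : ∀ n (f g : Fin n → ℚ) → sumℚ n (λ i → f i + g i) ≡ sumℚ n f + sumℚ n g
sumℚ-+ zero    f g = sym (+-identityˡ 0ℚ)
sumℚ-+ (suc n) f g =
  trans (cong ((f zero + g zero) +_) (sumℚ-+ n (f ∘ suc) (g ∘ suc)))
        (interchange (f zero) (g zero) (sumℚ n (f ∘ suc)) (sumℚ n (g ∘ suc)))

sumℚ-*ˡ : ∀ n c (f : Fin n → ℚ) → sumℚ n (λ i → c * f i) ≡ c * sumℚ n f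
sumℚ-*ˡ zero    c f = sym (*-zeroʳ c)
sumℚ-*ˡ (suc n) c f =
  trans (cong (c * f zero +_) (sumℚ-*ˡ n c (f ∘ suc))) (sym (*-distribˡ-+ c _ _))

sumℚ-*ʳ : ∀ n c (f : Fin n → ℚ) → sumℚ n (λ i → f i * c) ≡ sumℚ n f * c
sumℚ-*ʳ n c f =
  trans (sumℚ-cong (λ i → *-comm (f i) c)) (trans (sumℚ-*ˡ n c f) (*-comm c (sumℚ n f)))

sumℚ-comm : ∀ m n (F : Fin m → Fin n → ℚ) →
            sumℚ m (λ i → sumℚ n (F i)) ≡ sumℚ n (λ j → sumℚ m (λ i → F i j))
sumℚ-comm zero    n F = sym (sumℚ-zero n)
sumℚ-comm (suc m) n F =
  trans (cong (sumℚ n (F zero) +_) (sumℚ-comm m n (F ∘ suc)))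
        (sym (sumℚ-+ n (F zero) (λ j → sumℚ m (λ i → F (suc i) j))))

sumℚ-mono-≤ : ∀ {n} {f g : Fin n → ℚ} → (∀ i → f i ≤ g i) → sumℚ n f ≤ sumℚ n g
sumℚ-mono-≤ {zero}  f≤g = ≤-refl
sumℚ-mono-≤ {suc n} f≤g = +-mono-≤ (f≤g zero) (sumℚ-mono-≤ (f≤g ∘ suc))

sumℚ-nonNeg : ∀ {n} {f : Fin n → ℚ} → (∀ i → 0ℚ ≤ f i) → 0ℚ ≤ sumℚ n f
sumℚ-nonNeg {n} {f} 0≤f = subst (_≤ sumℚ n f) (sumℚ-zero n) (sumℚ-mono-≤ 0≤f)

f≤sumℚ : ∀ {n} {f : Fin n → ℚ} → (∀ i → 0ℚ ≤ f i) → ∀ i → f i ≤ sumℚ n f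
f≤sumℚ {suc n}     0≤f zero    = p≤p+q (sumℚ-nonNeg (0≤f ∘ suc))
f≤sumℚ {suc n} {f} 0≤f (suc i) =
  ≤-trans (f≤sumℚ (0≤f ∘ suc) i)
          (subst (_≤ f zero + sumℚ n (f ∘ suc)) (+-identityˡ _) (+-monoˡ-≤ _ (0≤f zero)))

sumℚ-δˡ : ∀ n (j : Fin n) (f : Fin n → ℚ) → sumℚ n (λ i → [ does (i ≟ j) ]· f i) ≡ f j
sumℚ-δˡ (suc n) zero    f = trans (cong (f zero +_) (sumℚ-zero n)) (+-identityʳ (f zero))
sumℚ-δˡ (suc n) (suc j) f = trans (+-identityˡ _) (sumℚ-δˡ n j (f ∘ suc))

sumℚ-δʳ : ∀ n (i : Fin n) (f : Fin n → ℚ) → sumℚ n (λ j → [ does (i ≟ j) ]· f j) ≡ f i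
sumℚ-δʳ (suc n) zero    f = trans (cong (f zero +_) (sumℚ-zero n)) (+-identityʳ (f zero))
sumℚ-δʳ (suc n) (suc i) f = trans (+-identityˡ _) (sumℚ-δʳ n i (f ∘ suc))

∧-≡-true : ∀ {x y} → x ∧ y ≡ true → x ≡ true × y ≡ true
∧-≡-true {true} {true} refl = refl , refl

∧-intro : ∀ {x y} → x ≡ true → y ≡ true → x ∧ y ≡ true
∧-intro refl refl = refl

anyFin-witness : ∀ n {f : Fin n → Bool} → anyFin n f ≡ true → Σ[ t ∈ Fin n ] f t ≡ true
anyFin-witness (suc n) {f} any-f with f zero in f₀
... | true  = zero , f₀
... | false = let (t , ft) = anyFin-witness n any-f in suc t , ft

anyFin-intro : ∀ n {f : Fin n → Bool} t → f t ≡ true → anyFin n f ≡ true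
anyFin-intro (suc n) {f} zero    ft = cong (_∨ anyFin n (f ∘ suc)) ft
anyFin-intro (suc n) {f} (suc t) ft =
  trans (cong (f zero ∨_) (anyFin-intro n t ft)) (∨-zeroʳ (f zero))

allFinB-elim : ∀ n {f : Fin n → Bool} → allFinB n f ≡ true → ∀ t → f t ≡ true
allFinB-elim (suc n) {f} all-f t       with f zero in f₀
allFinB-elim (suc n) {f} all-f zero    | true = f₀
allFinB-elim (suc n) {f} all-f (suc t) | true = allFinB-elim n all-f t

allFinB-intro : ∀ n {f : Fin n → Bool} → (∀ t → f t ≡ true) → allFinB n f ≡ true
allFinB-intro zero    ft = refl
allFinB-intro (suc n) ft = ∧-intro (ft zero) (allFinB-intro n (ft ∘ suc))

count-none : ∀ n {f : Fin n → Bool} → (∀ t → f t ≡ false) → count n f ≡ 0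
count-none zero    ft = refl
count-none (suc n) ft rewrite ft zero = count-none n (ft ∘ suc)

ℕtoℚ-count : ∀ n (f : Fin n → Bool) → ℕtoℚ (count n f) ≡ sumℚ n (𝟙 ∘ f)
ℕtoℚ-count zero    f = refl
ℕtoℚ-count (suc n) f with f zero
... | true  = trans (ℕtoℚ-suc (count n (f ∘ suc))) (cong (1ℚ +_) (ℕtoℚ-count n (f ∘ suc)))
... | false = trans (ℕtoℚ-count n (f ∘ suc)) (sym (+-identityˡ _))

𝟙-anyFin-≤ : ∀ n (f : Fin n → Bool) → 𝟙 (anyFin n f) ≤ sumℚ n (𝟙 ∘ f)
𝟙-anyFin-≤ zero    f = ≤-refl
𝟙-anyFin-≤ (suc n) f with f zero
... | true  = p≤p+q (sumℚ-nonNeg (𝟙-nonNeg ∘ f ∘ suc))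
... | false = subst (𝟙 (anyFin n (f ∘ suc)) ≤_) (sym (+-identityˡ _)) (𝟙-anyFin-≤ n (f ∘ suc))

sumℚ-𝟙-∧-δ : ∀ n b (i : Fin n) → sumℚ n (λ j → 𝟙 (b ∧ does (i ≟ j))) ≡ 𝟙 b
sumℚ-𝟙-∧-δ n true  i = sumℚ-δʳ n i (λ _ → 1ℚ)
sumℚ-𝟙-∧-δ n false i = sumℚ-zero n

sumList : (A → ℚ) → List A → ℚ
sumList φ xs = foldr _+_ 0ℚ (map φ xs)

sumList-cong : ∀ {φ ψ : A → ℚ} → (∀ x → φ x ≡ ψ x) → ∀ xs → sumList φ xs ≡ sumList ψ xs
sumList-cong φ≗ψ xs = cong (foldr _+_ 0ℚ) (List.map-cong φ≗ψ xs)

sumList-++ : ∀ (φ : A → ℚ) xs ys → sumList φ (xs ++ ys) ≡ sumList φ xs + sumList φ ys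
sumList-++ φ []       ys = sym (+-identityˡ _)
sumList-++ φ (x ∷ xs) ys = trans (cong (φ x +_) (sumList-++ φ xs ys)) (sym (+-assoc (φ x) _ _))

sumList-*ˡ : ∀ c (φ : A → ℚ) xs → sumList (λ x → c * φ x) xs ≡ c * sumList φ xs
sumList-*ˡ c φ []       = sym (*-zeroʳ c)
sumList-*ˡ c φ (x ∷ xs) = trans (cong (c * φ x +_) (sumList-*ˡ c φ xs)) (sym (*-distribˡ-+ c _ _))

sumList-tabulate : ∀ {n} (h : Fin n → A) (φ : A → ℚ) → sumList φ (tabulate h) ≡ sumℚ n (φ ∘ h)
sumList-tabulate {n = zero}  h φ = refl
sumList-tabulate {n = suc n} h φ = cong (φ (h zero) +_) (sumList-tabulate (h ∘ suc) φ)

sumList-map : ∀ (φ : B → ℚ) (h : A → B) xs → sumList φ (map h xs) ≡ sumList (φ ∘ h) xs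
sumList-map φ h xs = cong (foldr _+_ 0ℚ) (sym (List.map-∘ xs))

sumList-concatMap : ∀ (φ : B → ℚ) (F : A → List B) xs →
                    sumList φ (concatMap F xs) ≡ sumList (sumList φ ∘ F) xs
sumList-concatMap φ F []       = refl
sumList-concatMap φ F (x ∷ xs) =
  trans (sumList-++ φ (F x) (concatMap F xs)) (cong (sumList φ (F x) +_) (sumList-concatMap φ F xs))

maxList-attained : (ok : A → Bool) (v : A → ℚ) → (∀ a → 0ℚ ≤ v a) →
                   (a₀ : A) → ok a₀ ≡ true → (as : List A) →
                   Σ[ a ∈ A ] ok a ≡ true × maxList (map (λ c → [ ok c ]· v c) as) ≤ v a
maxList-attained ok v 0≤v a₀ ok₀ [] = a₀ , ok₀ , 0≤v a₀
maxList-attained ok v 0≤v a₀ ok₀ (a ∷ as)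
  with maxList-attained ok v 0≤v a₀ ok₀ as | ok a in ok-a
... | b , ok-b , max≤vb | false = b , ok-b , ⊔-lub (0≤v b) max≤vb
... | b , ok-b , max≤vb | true with ≤-total (v a) (v b)
...   | inj₁ va≤vb = b , ok-b , ⊔-lub va≤vb max≤vb
...   | inj₂ vb≤va = a , ok-a , ⊔-lub ≤-refl (≤-trans max≤vb vb≤va)

occurrences : ∀ {m n} → Fin m → Vec (Fin m) n → ℚ
occurrences {n = n} j s = sumℚ n (λ t → 𝟙 (does (lookup s t ≟ j)))

module Expectation {m : ℕ} (p : Fin m → ℚ) where

  𝔼 : (n : ℕ) → (Vec (Fin m) n → ℚ) → ℚ
  𝔼 zero    f = f []
  𝔼 (suc n) f = sumℚ m (λ x → p x * 𝔼 n (λ s → f (x ∷ s)))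

  𝔼-allVecs : ∀ n f →
    sumList (λ s → prodℚ n (λ t → p (lookup s t)) * f s) (allVecs (allFin m) n) ≡ 𝔼 n f
  𝔼-allVecs zero    f = trans (+-identityʳ _) (*-identityˡ (f []))
  𝔼-allVecs (suc n) f = begin
    sumList (λ s → Pr (suc n) s * f s) (concatMap (λ x → map (x ∷_) V) (allFin m))
      ≡⟨ sumList-concatMap _ (λ x → map (x ∷_) V) (allFin m) ⟩
    sumList (λ x → sumList (λ s → Pr (suc n) s * f s) (map (x ∷_) V)) (allFin m)
      ≡⟨ sumList-cong (λ x → trans (sumList-map _ (x ∷_) V) (draw x)) (allFin m) ⟩
    sumList (λ x → p x * 𝔼 n (λ s → f (x ∷ s))) (allFin m)
      ≡⟨ sumList-tabulate (λ x → x) (λ x → p x * 𝔼 n (λ s → f (x ∷ s))) ⟩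
    𝔼 (suc n) f ∎
    where
    open ≡-Reasoning
    V = allVecs (allFin m) n
    Pr : ∀ k → Vec (Fin m) k → ℚ
    Pr k s = prodℚ k (λ t → p (lookup s t))
    draw : ∀ x → sumList (λ s → (p x * Pr n s) * f (x ∷ s)) V ≡ p x * 𝔼 n (λ s → f (x ∷ s))
    draw x = trans (sumList-cong (λ s → *-assoc (p x) _ _) V)
                   (trans (sumList-*ˡ (p x) _ V) (cong (p x *_) (𝔼-allVecs n (λ s → f (x ∷ s)))))

  𝔼-zero : ∀ n → 𝔼 n (λ _ → 0ℚ) ≡ 0ℚ
  𝔼-zero zero    = refl
  𝔼-zero (suc n) =
    trans (sumℚ-cong (λ x → trans (cong (p x *_) (𝔼-zero n)) (*-zeroʳ (p x)))) (sumℚ-zero m)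

  𝔼-+ : ∀ n f g → 𝔼 n (λ s → f s + g s) ≡ 𝔼 n f + 𝔼 n g
  𝔼-+ zero    f g = refl
  𝔼-+ (suc n) f g =
    trans (sumℚ-cong (λ x → trans (cong (p x *_) (𝔼-+ n _ _)) (*-distribˡ-+ (p x) _ _)))
          (sumℚ-+ m _ _)

  𝔼-*ˡ : ∀ n c f → 𝔼 n (λ s → c * f s) ≡ c * 𝔼 n f
  𝔼-*ˡ zero    c f = refl
  𝔼-*ˡ (suc n) c f =
    trans (sumℚ-cong (λ x → trans (cong (p x *_) (𝔼-*ˡ n c _)) (x∙yz≈y∙xz (p x) c _)))
          (sumℚ-*ˡ m c _)

  𝔼-sumℚ : ∀ n k (F : Fin k → Vec (Fin m) n → ℚ) →
           𝔼 n (λ s → sumℚ k (λ j → F j s)) ≡ sumℚ k (λ j → 𝔼 n (F j))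
  𝔼-sumℚ zero    k F = refl
  𝔼-sumℚ (suc n) k F =
    trans (sumℚ-cong (λ x → trans (cong (p x *_) (𝔼-sumℚ n k _)) (sym (sumℚ-*ˡ k (p x) _))))
          (sumℚ-comm m k _)

  𝔼-[]· : ∀ n b f → 𝔼 n (λ s → [ b ]· f s) ≡ [ b ]· 𝔼 n f
  𝔼-[]· n true  f = refl
  𝔼-[]· n false f = 𝔼-zero n

  𝔼-sumℚ-[]· : ∀ n k (c : Fin k → Bool) (F : Fin k → Vec (Fin m) n → ℚ) →
               𝔼 n (λ s → sumℚ k (λ j → [ c j ]· F j s)) ≡ sumℚ k (λ j → [ c j ]· 𝔼 n (F j))
  𝔼-sumℚ-[]· n k c F = trans (𝔼-sumℚ n k _) (sumℚ-cong (λ j → 𝔼-[]· n (c j) (F j)))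

  module _ (p-nonNeg : ∀ x → 0ℚ ≤ p x) where

    𝔼-mono-≤ : ∀ n {f g} → (∀ s → f s ≤ g s) → 𝔼 n f ≤ 𝔼 n g
    𝔼-mono-≤ zero    f≤g = f≤g []
    𝔼-mono-≤ (suc n) f≤g =
      sumℚ-mono-≤ (λ x → *-monoˡ-≤-nonNeg′ (p-nonNeg x) (𝔼-mono-≤ n (λ s → f≤g (x ∷ s))))

    𝔼-nonNeg : ∀ n {f} → (∀ s → 0ℚ ≤ f s) → 0ℚ ≤ 𝔼 n f
    𝔼-nonNeg n {f} 0≤f = subst (_≤ 𝔼 n f) (𝔼-zero n) (𝔼-mono-≤ n 0≤f)

  module _ (p-sum : sumℚ m p ≡ 1ℚ) where

    sumℚ-p* : ∀ c → sumℚ m (λ x → p x * c) ≡ c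
    sumℚ-p* c = trans (sumℚ-*ʳ m c p) (trans (cong (_* c) p-sum) (*-identityˡ c))

    𝔼-const : ∀ n c → 𝔼 n (λ _ → c) ≡ c
    𝔼-const zero    c = refl
    𝔼-const (suc n) c = trans (sumℚ-cong (λ x → cong (p x *_) (𝔼-const n c))) (sumℚ-p* c)

    𝔼-occurrences : ∀ n j → 𝔼 n (occurrences j) ≡ ℕtoℚ n * p j
    𝔼-occurrences zero    j = sym (*-zeroˡ (p j))
    𝔼-occurrences (suc n) j = begin
      sumℚ m (λ x → p x * 𝔼 n (λ s → 𝟙 (does (x ≟ j)) + occurrences j s))
        ≡⟨ sumℚ-cong (λ x → cong (p x *_) (trans (𝔼-+ n _ _)
                       (cong₂ _+_ (𝔼-const n (𝟙 (does (x ≟ j)))) (𝔼-occurrences n j)))) ⟩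
      sumℚ m (λ x → p x * (𝟙 (does (x ≟ j)) + ℕtoℚ n * p j))
        ≡⟨ trans (sumℚ-cong (λ x → *-distribˡ-+ (p x) _ _)) (sumℚ-+ m _ _) ⟩
      sumℚ m (λ x → p x * 𝟙 (does (x ≟ j))) + sumℚ m (λ x → p x * (ℕtoℚ n * p j))
        ≡⟨ cong₂ _+_ (trans (sumℚ-cong (λ x → sym ([]·≡*𝟙 (does (x ≟ j)) (p x)))) (sumℚ-δˡ m j p))
                     (sumℚ-p* _) ⟩
      p j + ℕtoℚ n * p j
        ≡⟨ cong (_+ ℕtoℚ n * p j) (*-identityˡ (p j)) ⟨
      1ℚ * p j + ℕtoℚ n * p j
        ≡⟨ *-distribʳ-+ (p j) 1ℚ (ℕtoℚ n) ⟨
      (1ℚ + ℕtoℚ n) * p j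
        ≡⟨ cong (_* p j) (ℕtoℚ-suc n) ⟨
      ℕtoℚ (suc n) * p j ∎
      where open ≡-Reasoning

perRound : ∀ {m} → (Fin m → ℚ) → ℕ → Fin m → ℚ
perRound r T j = r j * inv T

module _ {m : ℕ} {r : Fin m → ℚ} (r-nonNeg : ∀ j → 0ℚ ≤ r j) where
  open Expectation

  perRound-nonNeg : ∀ T j → 0ℚ ≤ perRound r T j
  perRound-nonNeg T j = *-nonNeg (r-nonNeg j) (inv-nonNeg T)

  perRound-sum : ∀ n → sumℚ m r ≡ ℕtoℚ (suc n) → sumℚ m (perRound r (suc n)) ≡ 1ℚ
  perRound-sum n Σr = trans (sumℚ-*ʳ m (inv (suc n)) r)
                            (trans (cong (_* inv (suc n)) Σr) (ℕtoℚ*inv≡1 n))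

  -- For T = 0 the weights r j * inv 0 are junk (inv 0 = 0), but 𝔼 over zero
  -- rounds never reads them.
  𝔼-const-perRound : ∀ T → sumℚ m r ≡ ℕtoℚ T → ∀ c → 𝔼 (perRound r T) T (λ _ → c) ≡ c
  𝔼-const-perRound zero    Σr c = refl
  𝔼-const-perRound (suc n) Σr c = 𝔼-const (perRound r (suc n)) (perRound-sum n Σr) (suc n) c

  𝔼-occurrences-perRound : ∀ T → sumℚ m r ≡ ℕtoℚ T → ∀ j → 𝔼 (perRound r T) T (occurrences j) ≤ r j
  𝔼-occurrences-perRound zero    Σr j = r-nonNeg j
  𝔼-occurrences-perRound (suc n) Σr j = ≤-reflexive (begin
    𝔼 (perRound r (suc n)) (suc n) (occurrences j)
      ≡⟨ 𝔼-occurrences (perRound r (suc n)) (perRound-sum n Σr) (suc n) j ⟩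
    ℕtoℚ (suc n) * (r j * inv (suc n))
      ≡⟨ x∙yz≈y∙xz (ℕtoℚ (suc n)) (r j) (inv (suc n)) ⟩
    r j * (ℕtoℚ (suc n) * inv (suc n))
      ≡⟨ cong (r j *_) (ℕtoℚ*inv≡1 n) ⟩
    r j * 1ℚ
      ≡⟨ *-identityʳ (r j) ⟩
    r j ∎)
    where open ≡-Reasoning

module LPRelaxation (P : Instance)
                    (w-nonNeg : ∀ i k → 0ℚ ≤ Instance.w P i k)
                    (r-nonNeg : ∀ j → 0ℚ ≤ Instance.r P j)
                    (Σr≡T : sumℚ (Instance.nJ P) (Instance.r P) ≡ ℕtoℚ (Instance.T P)) where
  open Instance P
  open Expectation (perRound r T)

  -- feasible P s a unfolds to
  -- edgesRespected s a ∧ workerCapacitiesRespected s a ∧ taskCapacitiesRespected a.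
  edgesRespected : Seq P → Assignment P → Bool
  edgesRespected s a =
    allFinB T (λ t → allFinB nI (λ i → if assigned P a t i then E i (lookup s t) else true))

  workerCapacitiesRespected : Seq P → Assignment P → Bool
  workerCapacitiesRespected s a =
    allFinB T (λ t → count nI (λ i → assigned P a t i) ≤ᵇ bJ (lookup s t))

  taskCapacitiesRespected : Assignment P → Bool
  taskCapacitiesRespected a = allFinB nI (λ i → count T (λ t → assigned P a t i) ≤ᵇ bI i)

  empty : Assignment P
  empty = replicate T (replicate nI false)

  empty-unassigned : ∀ t i → assigned P empty t i ≡ false
  empty-unassigned t i =
    trans (cong (λ row → lookup row i) (lookup-replicate t (replicate nI false)))
          (lookup-replicate i false)

  empty-feasible : ∀ s → feasible P s empty ≡ true
  empty-feasible s = ∧-intro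
    (allFinB-intro T λ t → allFinB-intro nI λ i →
       cong (λ b → if b then E i (lookup s t) else true) (empty-unassigned t i))
    (∧-intro
      (allFinB-intro T λ t → cong (_≤ᵇ bJ (lookup s t)) (count-none nI (empty-unassigned t)))
      (allFinB-intro nI λ i → cong (_≤ᵇ bI i) (count-none T (λ t → empty-unassigned t i))))

  value-nonNeg : ∀ s a → 0ℚ ≤ value P s a
  value-nonNeg s a = sumℚ-nonNeg λ i → sumℚ-nonNeg λ k → []·-nonNeg _ (w-nonNeg i k)

  optimal-assignment : ∀ s → Σ[ a ∈ Assignment P ]
                                 feasible P s a ≡ true × clairvoyantOPT P s ≤ value P s a
  optimal-assignment s = maxList-attained (feasible P s) (value P s) (value-nonNeg s)
                                         empty (empty-feasible s) (allAssignments P)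

  opt : Seq P → Assignment P
  opt s = proj₁ (optimal-assignment s)

  opt-feasible : ∀ s → feasible P s (opt s) ≡ true
  opt-feasible s = proj₁ (proj₂ (optimal-assignment s))

  opt-optimal : ∀ s → clairvoyantOPT P s ≤ value P s (opt s)
  opt-optimal s = proj₂ (proj₂ (optimal-assignment s))

  serves : Seq P → Assignment P → Fin nI → Fin nJ → Bool
  serves s a i j = anyFin T (λ t → assigned P a t i ∧ does (lookup s t ≟ j))

  covers : Seq P → Assignment P → Fin nI → Fin nK → Bool
  covers s a i k = anyFin T (λ t → assigned P a t i ∧ χ (lookup s t) k)

  assignedOfType : Seq P → Assignment P → Fin nI → Fin nJ → ℚ
  assignedOfType s a i j = sumℚ T (λ t → 𝟙 (assigned P a t i ∧ does (lookup s t ≟ j)))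

  value-covers : ∀ s a → value P s a ≡ sumℚ nI (λ i → sumℚ nK (λ k → w i k * 𝟙 (covers s a i k)))
  value-covers s a = sumℚ-cong λ i → sumℚ-cong λ k → []·≡*𝟙 (covers s a i k) (w i k)

  𝟙-serves≤assignedOfType : ∀ s a i j → 𝟙 (serves s a i j) ≤ assignedOfType s a i j
  𝟙-serves≤assignedOfType s a i j = 𝟙-anyFin-≤ T _

  []·𝟙-serves≤assignedOfType : ∀ b s a i j → [ b ]· 𝟙 (serves s a i j) ≤ assignedOfType s a i j
  []·𝟙-serves≤assignedOfType b s a i j =
    ≤-trans ([]·-≤ b (𝟙-nonNeg (serves s a i j))) (𝟙-serves≤assignedOfType s a i j)

  assignedOfType≤occurrences : ∀ s a i j → assignedOfType s a i j ≤ occurrences j s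
  assignedOfType≤occurrences s a i j = sumℚ-mono-≤ λ t → 𝟙-∧-≤ʳ (assigned P a t i) _

  sumℚ-assignedOfType≡count : ∀ s a i →
    sumℚ nJ (assignedOfType s a i) ≡ ℕtoℚ (count T (λ t → assigned P a t i))
  sumℚ-assignedOfType≡count s a i = begin
    sumℚ nJ (λ j → sumℚ T (λ t → 𝟙 (assigned P a t i ∧ does (lookup s t ≟ j))))
      ≡⟨ sumℚ-comm nJ T _ ⟩
    sumℚ T (λ t → sumℚ nJ (λ j → 𝟙 (assigned P a t i ∧ does (lookup s t ≟ j))))
      ≡⟨ sumℚ-cong (λ t → sumℚ-𝟙-∧-δ nJ (assigned P a t i) (lookup s t)) ⟩
    sumℚ T (λ t → 𝟙 (assigned P a t i))
      ≡⟨ ℕtoℚ-count T (λ t → assigned P a t i) ⟨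
    ℕtoℚ (count T (λ t → assigned P a t i)) ∎
    where open ≡-Reasoning

  module _ (s : Seq P) (a : Assignment P) (feas : feasible P s a ≡ true) where

    private
      edges-ok : edgesRespected s a ≡ true
      edges-ok = proj₁ (∧-≡-true {edgesRespected s a} feas)

      capacities-ok : workerCapacitiesRespected s a ∧ taskCapacitiesRespected a ≡ true
      capacities-ok = proj₂ (∧-≡-true {edgesRespected s a} feas)

      workers-ok : workerCapacitiesRespected s a ≡ true
      workers-ok = proj₁ (∧-≡-true {workerCapacitiesRespected s a} capacities-ok)

      tasks-ok : taskCapacitiesRespected a ≡ true
      tasks-ok = proj₂ (∧-≡-true {workerCapacitiesRespected s a} capacities-ok)

    assigned⇒edge : ∀ {t i} → assigned P a t i ≡ true → E i (lookup s t) ≡ true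
    assigned⇒edge {t} {i} at-i =
      subst (λ b → (if b then E i (lookup s t) else true) ≡ true) at-i
            (allFinB-elim nI (allFinB-elim T edges-ok t) i)

    worker-capacity : ∀ t → count nI (λ i → assigned P a t i) ℕ.≤ bJ (lookup s t)
    worker-capacity t = ≤ᵇ⇒≤ _ _ (Equivalence.from T-≡ (allFinB-elim T workers-ok t))

    task-capacity : ∀ i → count T (λ t → assigned P a t i) ℕ.≤ bI i
    task-capacity i = ≤ᵇ⇒≤ _ _ (Equivalence.from T-≡ (allFinB-elim nI tasks-ok i))

    𝟙-covers≤sumℚ-serves : ∀ i k →
      𝟙 (covers s a i k) ≤ sumℚ nJ (λ j → [ E i j ∧ χ j k ]· 𝟙 (serves s a i j))
    𝟙-covers≤sumℚ-serves i k with covers s a i k in covered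
    ... | false = sumℚ-nonNeg λ j → []·-nonNeg (E i j ∧ χ j k) (𝟙-nonNeg (serves s a i j))
    ... | true  =
      let (t , at-i∧χ) = anyFin-witness T covered
          (at-i , χ-k) = ∧-≡-true at-i∧χ
          served       = anyFin-intro T t (∧-intro at-i (dec-true (lookup s t ≟ lookup s t) refl))
      in subst (_≤ sumℚ nJ (λ j → [ E i j ∧ χ j k ]· 𝟙 (serves s a i j)))
               ([]·𝟙-true (∧-intro (assigned⇒edge at-i) χ-k) served)
               (f≤sumℚ (λ j → []·-nonNeg (E i j ∧ χ j k) (𝟙-nonNeg (serves s a i j))) (lookup s t))

    sumℚ-serves≤bI : ∀ i → sumℚ nJ (λ j → [ E i j ]· 𝟙 (serves s a i j)) ≤ ℕtoℚ (bI i)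
    sumℚ-serves≤bI i = begin
      sumℚ nJ (λ j → [ E i j ]· 𝟙 (serves s a i j))
        ≤⟨ sumℚ-mono-≤ (λ j → []·𝟙-serves≤assignedOfType (E i j) s a i j) ⟩
      sumℚ nJ (assignedOfType s a i)
        ≡⟨ sumℚ-assignedOfType≡count s a i ⟩
      ℕtoℚ (count T (λ t → assigned P a t i))
        ≤⟨ ℕtoℚ-mono-≤ (task-capacity i) ⟩
      ℕtoℚ (bI i) ∎
      where open ≤-Reasoning

    sumℚ-round≤bJ : ∀ t j → sumℚ nI (λ i → 𝟙 (assigned P a t i ∧ does (lookup s t ≟ j)))
                         ≤ ℕtoℚ (bJ j) * 𝟙 (does (lookup s t ≟ j))
    sumℚ-round≤bJ t j with lookup s t ≟ j
    ... | yes refl = begin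
      sumℚ nI (λ i → 𝟙 (assigned P a t i ∧ true))
        ≡⟨ sumℚ-cong (λ i → cong 𝟙 (∧-identityʳ (assigned P a t i))) ⟩
      sumℚ nI (λ i → 𝟙 (assigned P a t i))
        ≡⟨ ℕtoℚ-count nI (λ i → assigned P a t i) ⟨
      ℕtoℚ (count nI (λ i → assigned P a t i))
        ≤⟨ ℕtoℚ-mono-≤ (worker-capacity t) ⟩
      ℕtoℚ (bJ (lookup s t))
        ≡⟨ *-identityʳ (ℕtoℚ (bJ (lookup s t))) ⟨
      ℕtoℚ (bJ (lookup s t)) * 1ℚ ∎
      where open ≤-Reasoning
    ... | no _ = ≤-reflexive (begin
      sumℚ nI (λ i → 𝟙 (assigned P a t i ∧ false))
        ≡⟨ sumℚ-cong (λ i → cong 𝟙 (∧-zeroʳ (assigned P a t i))) ⟩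
      sumℚ nI (λ _ → 0ℚ)
        ≡⟨ sumℚ-zero nI ⟩
      0ℚ
        ≡⟨ *-zeroʳ (ℕtoℚ (bJ j)) ⟨
      ℕtoℚ (bJ j) * 0ℚ ∎)
      where open ≡-Reasoning

    sumℚ-serves≤bJ*occurrences : ∀ j →
      sumℚ nI (λ i → [ E i j ]· 𝟙 (serves s a i j)) ≤ ℕtoℚ (bJ j) * occurrences j s
    sumℚ-serves≤bJ*occurrences j = begin
      sumℚ nI (λ i → [ E i j ]· 𝟙 (serves s a i j))
        ≤⟨ sumℚ-mono-≤ (λ i → []·𝟙-serves≤assignedOfType (E i j) s a i j) ⟩
      sumℚ nI (λ i → assignedOfType s a i j)
        ≡⟨ sumℚ-comm nI T _ ⟩
      sumℚ T (λ t → sumℚ nI (λ i → 𝟙 (assigned P a t i ∧ does (lookup s t ≟ j))))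
        ≤⟨ sumℚ-mono-≤ (λ t → sumℚ-round≤bJ t j) ⟩
      sumℚ T (λ t → ℕtoℚ (bJ j) * 𝟙 (does (lookup s t ≟ j)))
        ≡⟨ sumℚ-*ˡ T (ℕtoℚ (bJ j)) _ ⟩
      ℕtoℚ (bJ j) * occurrences j s ∎
      where open ≤-Reasoning

  𝔼-mono : ∀ {f g : Seq P → ℚ} → (∀ s → f s ≤ g s) → 𝔼 T f ≤ 𝔼 T g
  𝔼-mono = 𝔼-mono-≤ (perRound-nonNeg r-nonNeg T) T

  𝔼-𝟙-bounds : ∀ (f : Seq P → Bool) → (0ℚ ≤ 𝔼 T (𝟙 ∘ f)) × (𝔼 T (𝟙 ∘ f) ≤ 1ℚ)
  𝔼-𝟙-bounds f =
    𝔼-nonNeg (perRound-nonNeg r-nonNeg T) T (𝟙-nonNeg ∘ f) ,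
    ≤-trans (𝔼-mono (𝟙-≤1 ∘ f)) (≤-reflexive (𝔼-const-perRound r-nonNeg T Σr≡T 1ℚ))

  x : Fin nI → Fin nJ → ℚ
  x i j = 𝔼 T (λ s → 𝟙 (serves s (opt s) i j))

  z : Fin nI → Fin nK → ℚ
  z i k = 𝔼 T (λ s → 𝟙 (covers s (opt s) i k))

  z≤coverSum : ∀ i k → z i k ≤ coverSum P x i k
  z≤coverSum i k = begin
    z i k
      ≤⟨ 𝔼-mono (λ s → 𝟙-covers≤sumℚ-serves s (opt s) (opt-feasible s) i k) ⟩
    𝔼 T (λ s → sumℚ nJ (λ j → [ E i j ∧ χ j k ]· 𝟙 (serves s (opt s) i j)))
      ≡⟨ 𝔼-sumℚ-[]· T nJ _ _ ⟩
    coverSum P x i k ∎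
    where open ≤-Reasoning

  sumℚ-x≤bI : ∀ i → sumℚ nJ (λ j → [ E i j ]· x i j) ≤ ℕtoℚ (bI i)
  sumℚ-x≤bI i = begin
    sumℚ nJ (λ j → [ E i j ]· x i j)
      ≡⟨ 𝔼-sumℚ-[]· T nJ _ _ ⟨
    𝔼 T (λ s → sumℚ nJ (λ j → [ E i j ]· 𝟙 (serves s (opt s) i j)))
      ≤⟨ 𝔼-mono (λ s → sumℚ-serves≤bI s (opt s) (opt-feasible s) i) ⟩
    𝔼 T (λ _ → ℕtoℚ (bI i))
      ≡⟨ 𝔼-const-perRound r-nonNeg T Σr≡T (ℕtoℚ (bI i)) ⟩
    ℕtoℚ (bI i) ∎
    where open ≤-Reasoning

  x≤r : ∀ i j → x i j ≤ r j
  x≤r i j = begin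
    x i j
      ≤⟨ 𝔼-mono (λ s → ≤-trans (𝟙-serves≤assignedOfType s (opt s) i j)
                               (assignedOfType≤occurrences s (opt s) i j)) ⟩
    𝔼 T (occurrences j)
      ≤⟨ 𝔼-occurrences-perRound r-nonNeg T Σr≡T j ⟩
    r j ∎
    where open ≤-Reasoning

  sumℚ-x≤bJ*r : ∀ j → sumℚ nI (λ i → [ E i j ]· x i j) ≤ ℕtoℚ (bJ j) * r j
  sumℚ-x≤bJ*r j = begin
    sumℚ nI (λ i → [ E i j ]· x i j)
      ≡⟨ 𝔼-sumℚ-[]· T nI _ _ ⟨
    𝔼 T (λ s → sumℚ nI (λ i → [ E i j ]· 𝟙 (serves s (opt s) i j)))
      ≤⟨ 𝔼-mono (λ s → sumℚ-serves≤bJ*occurrences s (opt s) (opt-feasible s) j) ⟩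
    𝔼 T (λ s → ℕtoℚ (bJ j) * occurrences j s)
      ≡⟨ 𝔼-*ˡ T (ℕtoℚ (bJ j)) (occurrences j) ⟩
    ℕtoℚ (bJ j) * 𝔼 T (occurrences j)
      ≤⟨ *-monoˡ-≤-nonNeg′ (ℕtoℚ-nonNeg (bJ j)) (𝔼-occurrences-perRound r-nonNeg T Σr≡T j) ⟩
    ℕtoℚ (bJ j) * r j ∎
    where open ≤-Reasoning

  x-z-feasible : LPFeasible P x z
  x-z-feasible =
    (λ i k → proj₂ (𝔼-𝟙-bounds _) , z≤coverSum i k) , sumℚ-x≤bI , (λ i j _ → x≤r i j) ,
    sumℚ-x≤bJ*r , (λ i j _ → 𝔼-𝟙-bounds _) , (λ i k → 𝔼-𝟙-bounds _)

  expectedOPT≤objective : expectedOPT P ≤ LPObjective P z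
  expectedOPT≤objective = begin
    expectedOPT P
      ≡⟨ 𝔼-allVecs T (clairvoyantOPT P) ⟩
    𝔼 T (clairvoyantOPT P)
      ≤⟨ 𝔼-mono (λ s → ≤-trans (opt-optimal s) (≤-reflexive (value-covers s (opt s)))) ⟩
    𝔼 T (λ s → sumℚ nI (λ i → sumℚ nK (λ k → w i k * 𝟙 (covers s (opt s) i k))))
      ≡⟨ 𝔼-sumℚ T nI _ ⟩
    sumℚ nI (λ i → 𝔼 T (λ s → sumℚ nK (λ k → w i k * 𝟙 (covers s (opt s) i k))))
      ≡⟨ sumℚ-cong (λ i → trans (𝔼-sumℚ T nK _) (sumℚ-cong λ k → 𝔼-*ˡ T (w i k) _)) ⟩
    LPObjective P z ∎
    where open ≤-Reasoning

lemma2 : (P : Instance) → WellFormed P → LPValueAtLeast P (expectedOPT P)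
lemma2 P (w-bounds , _ , _ , r-pos , Σr≡T) = x , z , x-z-feasible , expectedOPT≤objective
  where open LPRelaxation P (λ i k → proj₁ (w-bounds i k)) (λ j → <⇒≤ (r-pos j)) Σr≡T
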